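{- Let $G$ be a complete wheel with $n\geq6$ vertices, cycle $C=\{c_1,\dots,c_{n-1}\}$ and central vertex $h$. Any set $X\subseteq V$ satisfying the condition "for every $i$, if $c_i,c_{i+1}\notin X$ then $c_{i-3},c_{i-2},c_{i-1},c_{i+2},c_{i+3},c_{i+4}\in X$" contains at least $\lfloor n/2\rfloor$ cycle vertices. Furthermore, if $L\subseteq V$ satisfies $|L\cap C|\geq4$, then for every $i$ the pair $h,c_i$ is separated by at least two vertices of $L\cap C$; and in this case, if $L$ is an AP-landmark set for parameter $k=2$, then $L\setminus\{h\}$ is also an AP-landmark set for parameter $2$.
   Context: The complete wheel on $n$ vertices has vertex set $V=C\cup\{h\}$ with $C=\{c_1,\dots,c_{n-1}\}$, edges $\{c_i,h\}$ and $\{c_i,c_{i+1}\}$ for $1\le i\le n-1$, indices modulo $n-1$. $d(x,y)$ denotes graph distance; $\tau$ separates distinct $u,v$ if $d(u,\tau)\neq d(v,\tau)$. $L\subseteq V$ is an AP-landmark set for parameter $k$ if every pair of distinct $u,v\in V$ is separated by at least $k$ distinct vertices of $L$. -}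

module Defs where

open import Data.Nat using (ℕ; zero; suc; _+_; _*_; _∸_; _<_)
open import Data.Nat.DivMod using (_mod_)
open import Data.Fin using (Fin; toℕ) renaming (zero to fzero; suc to fsuc)
open import Data.Fin.Subset using (Subset; _∈_; _∩_; ∁; ⁅_⁆)
open import Data.Product using (Σ; ∃; _×_)
open import Relation.Binary.PropositionalEquality using (_≡_; _≢_)
open import Relation.Nullary using (¬_)
open import Function.Definitions using (Injective)

-- Complete wheel on n = suc m vertices, vertex set Fin (suc m):
--   hub h is fzero, cycle vertex c_i (i : Fin m) is fsuc i.

_⊕_ : ∀ {m} → Fin m → ℕ → Fin m
_⊕_ {suc k} i j = (toℕ i + j) mod (suc k)

-- subtraction of a natural number from a cycle index, modulo m
_⊖_ : ∀ {m} → Fin m → ℕ → Fin m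
_⊖_ {m} i j = i ⊕ (m * j ∸ j)

hub : ∀ {m} → Fin (suc m)
hub = fzero

cyc : ∀ {m} → Fin m → Fin (suc m)
cyc = fsuc

C : ∀ {m} → Subset (suc m)
C = ∁ ⁅ hub ⁆

data Adj {m : ℕ} : Fin (suc m) → Fin (suc m) → Set where
  hub-cyc  : (i : Fin m) → Adj hub (cyc i)
  cyc-hub  : (i : Fin m) → Adj (cyc i) hub
  cyc-next : (i : Fin m) → Adj (cyc i) (cyc (i ⊕ 1))
  next-cyc : (i : Fin m) → Adj (cyc (i ⊕ 1)) (cyc i)

data Walk {m : ℕ} : ℕ → Fin (suc m) → Fin (suc m) → Set where
  here : ∀ {u} → Walk 0 u u
  step : ∀ {k u w v} → Adj u w → Walk k w v → Walk (suc k) u v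

Dist : ∀ {m} → Fin (suc m) → Fin (suc m) → ℕ → Set
Dist u v d = Walk d u v × (∀ j → j < d → ¬ Walk j u v)

Separates : ∀ {m} → Fin (suc m) → Fin (suc m) → Fin (suc m) → Set
Separates u v τ = ∃ λ a → ∃ λ b → Dist u τ a × Dist v τ b × a ≢ b

SeparatedByAtLeast : ∀ {m} → ℕ → Subset (suc m) → Fin (suc m) → Fin (suc m) → Set
SeparatedByAtLeast {m} k S u v =
  Σ (Fin k → Fin (suc m)) λ f →
    Injective _≡_ _≡_ f × (∀ j → f j ∈ S × Separates u v (f j))

IsAPLandmark : ∀ {m} → ℕ → Subset (suc m) → Set
IsAPLandmark {m} k L = ∀ (u v : Fin (suc m)) → u ≢ v → SeparatedByAtLeast k L u v

GapCondition : ∀ {m} → Subset (suc m) → Set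
GapCondition {m} X = ∀ (i : Fin m) →
  ¬ (cyc i ∈ X) → ¬ (cyc (i ⊕ 1) ∈ X) →
  cyc (i ⊖ 3) ∈ X × cyc (i ⊖ 2) ∈ X × cyc (i ⊖ 1) ∈ X ×
  cyc (i ⊕ 2) ∈ X × cyc (i ⊕ 3) ∈ X × cyc (i ⊕ 4) ∈ X

module Submission where

-- Let X satisfy the gap condition.  In every
-- window c_j, c_{j+1}, c_{j+2}, c_{j+3} of four consecutive cycle vertices
-- at least two lie in X: if at most one did, two adjacent ones would be
-- missing, and the gap condition puts the two others into X.  Summing over
-- the m windows counts every cycle vertex exactly four times (a rotation of
-- the cycle is a permutation), so 2m ≤ 4 ∣X ∩ C∣, i.e. ⌈m/2⌉ ≤ ∣X ∩ C∣.
--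
-- The hub h is at distance 1 from every c_j, while c_i
-- is at distance 0 from itself and 2 from every cycle vertex other than its
-- two neighbours.  Hence each landmark of L ∩ C outside {c_{i-1}, c_{i+1}}
-- separates h and c_i, and ∣L ∩ C∣ ≥ 4 leaves two of them.  Finally h never
-- separates two cycle vertices (both are at distance 1), so every landmark
-- separating two cycle vertices lies in L - h; pairs involving h are handled
-- by the previous statement.
--
-- The bound n ≥ 6 is
-- used only to exclude the empty cycle.

open import Defs
open import Data.Bool using (Bool; true; false)
open import Data.Empty using (⊥-elim)
open import Data.Fin using (Fin; toℕ) renaming (zero to fzero; suc to fsuc)
open import Data.Fin.Permutation using (Permutation; permutation)
open import Data.Fin.Properties using (_≟_; toℕ-injective; toℕ<n; toℕ-fromℕ<)
  renaming (suc-injective to fsuc-injective)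
open import Data.Fin.Subset
  using (Subset; ∣_∣; _∩_; _-_; ∁; ⊥; ⁅_⁆; _∈_; _∉_; Nonempty)
open import Data.Fin.Subset.Properties
  using (x∈p∩q⁻; x∈∁p⇒x∉p; x∈p∧x∉q⇒x∈p─q; x∈p∧x≢y⇒x∈p-y; p─q⊆p; p─⊥≡p;
         nonempty?; Empty-unique; ∣⊥∣≡0)
open import Data.Nat using (ℕ; zero; suc; _+_; _*_; _∸_; _≤_; _<_; _/_; _%_; z≤n; s≤s; s≤s⁻¹)
open import Data.Nat.DivMod
  using (m%n<n; m%n%n≡m%n; %-distribˡ-+; [m+kn]%n≡m%n; m<n⇒m%n≡m; m<n*o⇒m/o<n)
open import Data.Nat.Properties
  using (+-assoc; +-comm; *-comm; *-assoc; m≤m+n; m+[n∸m]≡n; +-mono-≤; *-cancelʳ-≤;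
         ≤-refl; ≤-trans; n≤1+n; <-cmp; +-0-commutativeMonoid)
open import Algebra.Properties.CommutativeMonoid.Sum +-0-commutativeMonoid
  using (sum; sum-syntax; sum-permute; sum-cong-≗; ∑-comm)
open import Data.Product using (Σ; _×_; _,_; proj₁; proj₂)
open import Data.Sum using (_⊎_; inj₁; inj₂)
open import Data.Vec using ([]; _∷_; lookup; here; there)
open import Data.Vec.Properties using ([]=⇒lookup)
open import Function.Definitions using (Injective)
open import Relation.Binary using (tri<; tri≈; tri>)
open import Relation.Binary.PropositionalEquality
  using (_≡_; _≢_; refl; sym; trans; cong; subst; module ≡-Reasoning)
open import Relation.Nullary using (¬_; yes; no; contradiction)

module _ {k : ℕ} where

  private
    N : ℕ
    N = suc k

  toℕ-⊕ : (i : Fin N) (a : ℕ) → toℕ (i ⊕ a) ≡ (toℕ i + a) % N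
  toℕ-⊕ i a = toℕ-fromℕ< (m%n<n (toℕ i + a) N)

  %-absorbˡ : (a b : ℕ) → (a % N + b) % N ≡ (a + b) % N
  %-absorbˡ a b = begin
    (a % N + b) % N           ≡⟨ %-distribˡ-+ (a % N) b N ⟩
    (a % N % N + b % N) % N   ≡⟨ cong (λ z → (z + b % N) % N) (m%n%n≡m%n a N) ⟩
    (a % N + b % N) % N       ≡⟨ sym (%-distribˡ-+ a b N) ⟩
    (a + b) % N               ∎
    where open ≡-Reasoning

  ⊕-assoc : (i : Fin N) (a b : ℕ) → (i ⊕ a) ⊕ b ≡ i ⊕ (a + b)
  ⊕-assoc i a b = toℕ-injective (begin
    toℕ ((i ⊕ a) ⊕ b)           ≡⟨ toℕ-⊕ (i ⊕ a) b ⟩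
    (toℕ (i ⊕ a) + b) % N       ≡⟨ cong (λ z → (z + b) % N) (toℕ-⊕ i a) ⟩
    ((toℕ i + a) % N + b) % N   ≡⟨ %-absorbˡ (toℕ i + a) b ⟩
    (toℕ i + a + b) % N         ≡⟨ cong (_% N) (+-assoc (toℕ i) a b) ⟩
    (toℕ i + (a + b)) % N       ≡⟨ sym (toℕ-⊕ i (a + b)) ⟩
    toℕ (i ⊕ (a + b))           ∎)
    where open ≡-Reasoning

  ⊕-multiple : (i : Fin N) (c : ℕ) → i ⊕ (c * N) ≡ i
  ⊕-multiple i c = toℕ-injective (trans (toℕ-⊕ i (c * N))
    (trans ([m+kn]%n≡m%n (toℕ i) c N) (m<n⇒m%n≡m (toℕ<n i))))

  shift-cancel : (a : ℕ) → a + (N * a ∸ a) ≡ a * N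
  shift-cancel a = trans (m+[n∸m]≡n (m≤m+n a (k * a))) (*-comm N a)

  ⊕⊖ : (i : Fin N) (a : ℕ) → (i ⊕ a) ⊖ a ≡ i
  ⊕⊖ i a = trans (⊕-assoc i a (N * a ∸ a))
    (trans (cong (i ⊕_) (shift-cancel a)) (⊕-multiple i a))

  ⊖⊕ : (i : Fin N) (a : ℕ) → (i ⊖ a) ⊕ a ≡ i
  ⊖⊕ i a = trans (⊕-assoc i (N * a ∸ a) a)
    (trans (cong (i ⊕_) (trans (+-comm (N * a ∸ a) a) (shift-cancel a))) (⊕-multiple i a))

  ⊕⊖-shift : (j : Fin N) (r s : ℕ) → (j ⊕ (r + s)) ⊖ s ≡ j ⊕ r
  ⊕⊖-shift j r s = trans (cong (_⊖ s) (sym (⊕-assoc j r s))) (⊕⊖ (j ⊕ r) s)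

  rotation : ℕ → Permutation N N
  rotation a = permutation (_⊕ a) (_⊖ a) (λ i → ⊖⊕ i a) (λ i → ⊕⊖ i a)

sum-const : ∀ n (c : ℕ) → ∑[ j < n ] c ≡ n * c
sum-const zero    c = refl
sum-const (suc n) c = cong (c +_) (sum-const n c)

sum-mono : ∀ {n} (f g : Fin n → ℕ) → (∀ j → f j ≤ g j) → sum f ≤ sum g
sum-mono {zero}  f g f≤g = z≤n
sum-mono {suc n} f g f≤g =
  +-mono-≤ (f≤g fzero) (sum-mono (λ j → f (fsuc j)) (λ j → g (fsuc j)) (λ j → f≤g (fsuc j)))

module _ {k : ℕ} where

  private
    N : ℕ
    N = suc k

  sum-rotate : (v : Fin N → ℕ) (a : ℕ) → ∑[ j < N ] v (j ⊕ a) ≡ sum v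
  sum-rotate v a = sym (sum-permute v (rotation a))

  window : (v : Fin N → ℕ) (w : ℕ) → Fin N → ℕ
  window v w j = ∑[ r < w ] v (j ⊕ toℕ r)

  -- Every position lies in exactly w windows of length w.
  sum-window : (v : Fin N → ℕ) (w : ℕ) → sum (window v w) ≡ w * sum v
  sum-window v w = begin
    ∑[ j < N ] ∑[ r < w ] v (j ⊕ toℕ r)   ≡⟨ ∑-comm {N} {w} (λ j r → v (j ⊕ toℕ r)) ⟩
    ∑[ r < w ] ∑[ j < N ] v (j ⊕ toℕ r)   ≡⟨ sum-cong-≗ {w} (λ r → sum-rotate v (toℕ r)) ⟩
    ∑[ r < w ] sum v                      ≡⟨ sum-const w (sum v) ⟩
    w * sum v                             ∎
    where open ≡-Reasoning

  window-average : (v : Fin N → ℕ) (w t : ℕ) →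
    (∀ j → t ≤ window v w j) → N * t ≤ w * sum v
  window-average v w t t≤window = begin
    N * t                ≡⟨ sym (sum-const N t) ⟩
    ∑[ j < N ] t         ≤⟨ sum-mono (λ _ → t) (window v w) t≤window ⟩
    sum (window v w)     ≡⟨ sum-window v w ⟩
    w * sum v            ∎
    where open Data.Nat.Properties.≤-Reasoning

𝟙 : Bool → ℕ
𝟙 true  = 1
𝟙 false = 0

∣p∩∁⊥∣≡∑ : ∀ {n} (p : Subset n) → ∣ p ∩ ∁ ⊥ ∣ ≡ ∑[ j < n ] 𝟙 (lookup p j)
∣p∩∁⊥∣≡∑ []          = refl
∣p∩∁⊥∣≡∑ (true  ∷ p) = cong suc (∣p∩∁⊥∣≡∑ p)
∣p∩∁⊥∣≡∑ (false ∷ p) = ∣p∩∁⊥∣≡∑ p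

∣X∩C∣≡∑ : ∀ {m} (X : Subset (suc m)) → ∣ X ∩ C ∣ ≡ ∑[ j < m ] 𝟙 (lookup X (cyc j))
∣X∩C∣≡∑ (true  ∷ p) = ∣p∩∁⊥∣≡∑ p
∣X∩C∣≡∑ (false ∷ p) = ∣p∩∁⊥∣≡∑ p

half-bound : ∀ m s → m * 2 ≤ 4 * s → suc m / 2 ≤ s
half-bound m s 2m≤4s = s≤s⁻¹ (m<n*o⇒m/o<n {o = 2} (s≤s (s≤s m≤2s)))
  where
  4s≡2s*2 : 4 * s ≡ s * 2 * 2
  4s≡2s*2 = trans (*-comm 4 s) (sym (*-assoc s 2 2))

  m≤2s : m ≤ s * 2
  m≤2s = *-cancelʳ-≤ m (s * 2) 2 (subst (m * 2 ≤_) 4s≡2s*2 2m≤4s)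

two-of-four : (a b c d : Bool) →
  (a ≡ false → b ≡ false → c ≡ true × d ≡ true) →
  (b ≡ false → c ≡ false → a ≡ true × d ≡ true) →
  (c ≡ false → d ≡ false → a ≡ true × b ≡ true) →
  2 ≤ 𝟙 a + (𝟙 b + (𝟙 c + (𝟙 d + 0)))
two-of-four false false c d ab bc cd with ab refl refl
... | refl , refl = s≤s (s≤s z≤n)
two-of-four a false false d ab bc cd with bc refl refl
... | refl , refl = s≤s (s≤s z≤n)
two-of-four a b false false ab bc cd with cd refl refl
... | refl , refl = s≤s (s≤s z≤n)
two-of-four true  true  c     d     _ _ _ = s≤s (s≤s z≤n)
two-of-four true  false true  d     _ _ _ = s≤s (s≤s z≤n)
two-of-four false true  true  d     _ _ _ = s≤s (s≤s z≤n)
two-of-four false true  false true  _ _ _ = s≤s (s≤s z≤n)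

∈⇒lookup≡true : ∀ {n} {p : Subset n} {x} → x ∈ p → lookup p x ≡ true
∈⇒lookup≡true = []=⇒lookup

lookup≡false⇒∉ : ∀ {n} {p : Subset n} {x} → lookup p x ≡ false → x ∉ p
lookup≡false⇒∉ x-out x∈p with trans (sym x-out) (∈⇒lookup≡true x∈p)
... | ()

onCycle : ∀ {m} → Subset (suc m) → Fin m → ℕ
onCycle X i = 𝟙 (lookup X (cyc i))

-- Every window of four consecutive cycle vertices meets a gap set twice: two
-- adjacent missing vertices of the window force the other two into X.
gap-window : ∀ {k} (X : Subset (suc (suc k))) → GapCondition X →
  ∀ j → 2 ≤ window (onCycle X) 4 j
gap-window X gap j = two-of-four (at 0) (at 1) (at 2) (at 3) gap₀ gap₁ gap₂
  where
  at : ℕ → Bool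
  at r = lookup X (cyc (j ⊕ r))

  present : ∀ {i} r → i ≡ j ⊕ r → cyc i ∈ X → at r ≡ true
  present r refl = ∈⇒lookup≡true

  gap-at : ∀ r → at r ≡ false → at (r + 1) ≡ false →
    let i = j ⊕ r in
    cyc (i ⊖ 3) ∈ X × cyc (i ⊖ 2) ∈ X × cyc (i ⊖ 1) ∈ X ×
    cyc (i ⊕ 2) ∈ X × cyc (i ⊕ 3) ∈ X × cyc (i ⊕ 4) ∈ X
  gap-at r out₀ out₁ = gap (j ⊕ r) (lookup≡false⇒∉ out₀)
    (lookup≡false⇒∉ (trans (cong (λ i → lookup X (cyc i)) (⊕-assoc j r 1)) out₁))

  gap₀ : at 0 ≡ false → at 1 ≡ false → at 2 ≡ true × at 3 ≡ true
  gap₀ out₀ out₁ with gap-at 0 out₀ out₁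
  ... | _ , _ , _ , in₂ , in₃ , _ = present 2 (⊕-assoc j 0 2) in₂ , present 3 (⊕-assoc j 0 3) in₃

  gap₁ : at 1 ≡ false → at 2 ≡ false → at 0 ≡ true × at 3 ≡ true
  gap₁ out₁ out₂ with gap-at 1 out₁ out₂
  ... | _ , _ , in₀ , in₃ , _ = present 0 (⊕⊖-shift j 0 1) in₀ , present 3 (⊕-assoc j 1 2) in₃

  gap₂ : at 2 ≡ false → at 3 ≡ false → at 0 ≡ true × at 1 ≡ true
  gap₂ out₂ out₃ with gap-at 2 out₂ out₃
  ... | _ , in₀ , in₁ , _ = present 0 (⊕⊖-shift j 0 2) in₀ , present 1 (⊕⊖-shift j 1 1) in₁

-- Part (a): a gap set contains at least ⌈m/2⌉ = ⌊n/2⌋ cycle vertices.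
gap-set-bound : ∀ {k} (X : Subset (suc (suc k))) → GapCondition X →
  suc (suc k) / 2 ≤ ∣ X ∩ C ∣
gap-set-bound {k} X gap = subst (suc (suc k) / 2 ≤_) (sym (∣X∩C∣≡∑ X))
  (half-bound (suc k) _ (window-average (onCycle X) 4 2 (gap-window X gap)))

walk-length-0 : ∀ {m} {u v : Fin (suc m)} → Walk 0 u v → u ≡ v
walk-length-0 here = refl

walk-length-1 : ∀ {m} {u v : Fin (suc m)} → Walk 1 u v → Adj u v
walk-length-1 (step adj here) = adj

dist-unique : ∀ {m} {u v : Fin (suc m)} {a b} → Dist u v a → Dist u v b → a ≡ b
dist-unique {a = a} {b} (walk-a , min-a) (walk-b , min-b) with <-cmp a b
... | tri< a<b _ _ = ⊥-elim (min-b a a<b walk-a)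
... | tri≈ _ a≡b _ = a≡b
... | tri> _ _ b<a = ⊥-elim (min-a b b<a walk-b)

dist-refl : ∀ {m} (u : Fin (suc m)) → Dist u u 0
dist-refl u = here , λ _ ()

dist-adjacent : ∀ {m} {u v : Fin (suc m)} → u ≢ v → Adj u v → Dist u v 1
dist-adjacent u≢v adj = step adj here , shorter
  where
  shorter : ∀ l → l < 1 → ¬ Walk l _ _
  shorter zero _ walk = u≢v (walk-length-0 walk)
  shorter (suc l) (s≤s ())

cyc-adjacent : ∀ {m} {i j : Fin m} → Adj (cyc i) (cyc j) → j ≡ i ⊕ 1 ⊎ i ≡ j ⊕ 1
cyc-adjacent (cyc-next i) = inj₁ refl
cyc-adjacent (next-cyc i) = inj₂ refl

dist-cyc-cyc : ∀ {m} {i j : Fin m} → i ≢ j → j ≢ i ⊕ 1 → i ≢ j ⊕ 1 →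
  Dist (cyc i) (cyc j) 2
dist-cyc-cyc {i = i} {j} i≢j j≢i+1 i≢j+1 = step (cyc-hub i) (step (hub-cyc j) here) , shorter
  where
  shorter : ∀ l → l < 2 → ¬ Walk l (cyc i) (cyc j)
  shorter zero          _ walk = i≢j (fsuc-injective (walk-length-0 walk))
  shorter (suc zero)    _ walk with cyc-adjacent (walk-length-1 walk)
  ... | inj₁ j≡i+1 = j≢i+1 j≡i+1
  ... | inj₂ i≡j+1 = i≢j+1 i≡j+1
  shorter (suc (suc l)) (s≤s (s≤s ()))

-- Every cycle vertex other than the two neighbours of c_i separates h and c_i:
-- it is at distance 1 from h and at distance 0 or 2 from c_i.
hub-separated-by : ∀ {k} (i j : Fin (suc k)) → j ≢ i ⊕ 1 → j ≢ i ⊖ 1 →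
  Separates hub (cyc i) (cyc j)
hub-separated-by i j j≢i+1 j≢i-1 with i ≟ j
... | yes refl = 1 , 0 , dist-adjacent (λ ()) (hub-cyc i) , dist-refl (cyc i) , λ ()
... | no i≢j   = 1 , 2 , dist-adjacent (λ ()) (hub-cyc j) , dist-cyc-cyc i≢j j≢i+1 i≢j+1 , λ ()
  where
  i≢j+1 : i ≢ j ⊕ 1
  i≢j+1 i≡j+1 = j≢i-1 (trans (sym (⊕⊖ j 1)) (cong (_⊖ 1) (sym i≡j+1)))

-- The hub is at distance 1 from every cycle vertex, so separates none of them.
hub-separates-no-cycle-pair : ∀ {m} (i i' : Fin m) → ¬ Separates (cyc i) (cyc i') hub
hub-separates-no-cycle-pair i i' (a , b , dist-a , dist-b , a≢b) =
  a≢b (trans (dist-unique dist-a (dist-adjacent (λ ()) (cyc-hub i)))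
             (dist-unique (dist-adjacent (λ ()) (cyc-hub i')) dist-b))

∣p∣≤1+∣p-x∣ : ∀ {n} (p : Subset n) (x : Fin n) → ∣ p ∣ ≤ suc ∣ p - x ∣
∣p∣≤1+∣p-x∣ (true  ∷ p) fzero    = subst (λ q → suc ∣ p ∣ ≤ suc ∣ q ∣) (sym (p─⊥≡p p)) ≤-refl
∣p∣≤1+∣p-x∣ (false ∷ p) fzero    = subst (λ q → ∣ p ∣ ≤ suc ∣ q ∣) (sym (p─⊥≡p p)) (n≤1+n ∣ p ∣)
∣p∣≤1+∣p-x∣ (true  ∷ p) (fsuc x) = s≤s (∣p∣≤1+∣p-x∣ p x)
∣p∣≤1+∣p-x∣ (false ∷ p) (fsuc x) = ∣p∣≤1+∣p-x∣ p x

x∈p-y⇒x≢y : ∀ {n} (p : Subset n) {x y : Fin n} → x ∈ p - y → x ≢ y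
x∈p-y⇒x≢y (_ ∷ p) {fzero}  {fzero}  ()
x∈p-y⇒x≢y (_ ∷ p) {fsuc x} {fsuc y} (there x∈p-y) x≡y = x∈p-y⇒x≢y p x∈p-y (fsuc-injective x≡y)

∈-remove⁻ : ∀ {n} (p : Subset n) (y : Fin n) {x : Fin n} → x ∈ p - y → x ∈ p × x ≢ y
∈-remove⁻ p y x∈p-y = p─q⊆p p ⁅ y ⁆ x∈p-y , x∈p-y⇒x≢y p x∈p-y

nonempty : ∀ {n} (p : Subset n) → 1 ≤ ∣ p ∣ → Nonempty p
nonempty {n} p 1≤∣p∣ with nonempty? p
... | yes p-nonempty = p-nonempty
... | no p-empty with trans (cong ∣_∣ (Empty-unique p-empty)) (∣⊥∣≡0 n)
...   | ∣p∣≡0 = contradiction (subst (1 ≤_) ∣p∣≡0 1≤∣p∣) λ ()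

two-members : ∀ {n} (p : Subset n) → 2 ≤ ∣ p ∣ →
  Σ (Fin n) λ x → Σ (Fin n) λ y → x ≢ y × x ∈ p × y ∈ p
two-members p 2≤∣p∣ with nonempty p (≤-trans (s≤s z≤n) 2≤∣p∣)
... | x , x∈p with nonempty (p - x) (s≤s⁻¹ (≤-trans 2≤∣p∣ (∣p∣≤1+∣p-x∣ p x)))
...   | y , y∈p-x with ∈-remove⁻ p x y∈p-x
...     | y∈p , y≢x = x , y , (λ x≡y → y≢x (sym x≡y)) , x∈p , y∈p

pair-separated : ∀ {m} {S : Subset (suc m)} {u v x y : Fin (suc m)} → x ≢ y →
  x ∈ S × Separates u v x → y ∈ S × Separates u v y → SeparatedByAtLeast 2 S u v
pair-separated {S = S} {x = x} {y} x≢y x-good y-good = pick , pick-injective , pick-good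
  where
  pick : Fin 2 → Fin _
  pick fzero    = x
  pick (fsuc _) = y

  pick-injective : Injective _≡_ _≡_ pick
  pick-injective {fzero}      {fzero}      _   = refl
  pick-injective {fzero}      {fsuc fzero} x≡y = ⊥-elim (x≢y x≡y)
  pick-injective {fsuc fzero} {fzero}      y≡x = ⊥-elim (x≢y (sym y≡x))
  pick-injective {fsuc fzero} {fsuc fzero} _   = refl

  pick-good : ∀ r → pick r ∈ S × Separates _ _ (pick r)
  pick-good fzero    = x-good
  pick-good (fsuc _) = y-good

separated-mono : ∀ {m k} {S S' : Subset (suc m)} {u v : Fin (suc m)} →
  (∀ {τ} → τ ∈ S → Separates u v τ → τ ∈ S') →
  SeparatedByAtLeast k S u v → SeparatedByAtLeast k S' u v
separated-mono S⇒S' (f , f-injective , f-good) =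
  f , f-injective , λ r → S⇒S' (proj₁ (f-good r)) (proj₂ (f-good r)) , proj₂ (f-good r)

separated-sym : ∀ {m k} {S : Subset (suc m)} {u v : Fin (suc m)} →
  SeparatedByAtLeast k S u v → SeparatedByAtLeast k S v u
separated-sym (f , f-injective , f-good) = f , f-injective , λ r → flip (f-good r)
  where
  flip : ∀ {τ} → τ ∈ _ × Separates _ _ τ → τ ∈ _ × Separates _ _ τ
  flip (τ∈S , a , b , dist-a , dist-b , a≢b) = τ∈S , b , a , dist-b , dist-a , λ b≡a → a≢b (sym b≡a)

cycle-vertex : ∀ {m} (x : Fin (suc m)) → x ∈ C → Σ (Fin m) λ j → x ≡ cyc j
cycle-vertex fzero    x∈C = ⊥-elim (x∈∁p⇒x∉p x∈C here)
cycle-vertex (fsuc j) _   = j , refl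

L∩C⊆L-hub : ∀ {m} (L : Subset (suc m)) {x} → x ∈ L ∩ C → x ∈ L - hub
L∩C⊆L-hub L x∈L∩C with x∈p∩q⁻ L C x∈L∩C
... | x∈L , x∈C = x∈p∧x∉q⇒x∈p─q x∈L (x∈∁p⇒x∉p {p = ⁅ hub ⁆} x∈C)

hub-cycle-separated : ∀ {k} (L : Subset (suc (suc k))) → 4 ≤ ∣ L ∩ C ∣ →
  (i : Fin (suc k)) → SeparatedByAtLeast 2 (L ∩ C) hub (cyc i)
hub-cycle-separated L 4≤∣L∩C∣ i = from-pair (two-members candidates 2≤∣candidates∣)
  where
  candidates : Subset _
  candidates = L ∩ C - cyc (i ⊕ 1) - cyc (i ⊖ 1)

  2≤∣candidates∣ : 2 ≤ ∣ candidates ∣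
  2≤∣candidates∣ = s≤s⁻¹ (s≤s⁻¹ (≤-trans 4≤∣L∩C∣ (≤-trans
    (∣p∣≤1+∣p-x∣ (L ∩ C) (cyc (i ⊕ 1)))
    (s≤s (∣p∣≤1+∣p-x∣ (L ∩ C - cyc (i ⊕ 1)) (cyc (i ⊖ 1)))))))

  good : ∀ {x} → x ∈ candidates → x ∈ L ∩ C × Separates hub (cyc i) x
  good {x} x∈candidates with ∈-remove⁻ (L ∩ C - cyc (i ⊕ 1)) (cyc (i ⊖ 1)) x∈candidates
  ... | x∈L∩C-c₊ , x≢c₋ with ∈-remove⁻ (L ∩ C) (cyc (i ⊕ 1)) x∈L∩C-c₊
  ...   | x∈L∩C , x≢c₊ with cycle-vertex x (proj₂ (x∈p∩q⁻ L C x∈L∩C))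
  ...     | j , refl =
    x∈L∩C , hub-separated-by i j (λ j≡i+1 → x≢c₊ (cong fsuc j≡i+1)) (λ j≡i-1 → x≢c₋ (cong fsuc j≡i-1))

  from-pair : Σ (Fin _) (λ x → Σ (Fin _) λ y → x ≢ y × x ∈ candidates × y ∈ candidates) →
    SeparatedByAtLeast 2 (L ∩ C) hub (cyc i)
  from-pair (x , y , x≢y , x∈ , y∈) = pair-separated x≢y (good x∈) (good y∈)

drop-hub : ∀ {k} (L : Subset (suc (suc k))) → 4 ≤ ∣ L ∩ C ∣ →
  IsAPLandmark 2 L → IsAPLandmark 2 (L - hub)
drop-hub L 4≤∣L∩C∣ L-landmark fzero    fzero     u≢v = ⊥-elim (u≢v refl)
drop-hub L 4≤∣L∩C∣ L-landmark fzero    (fsuc i)  _   =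
  separated-mono (λ τ∈ _ → L∩C⊆L-hub L τ∈) (hub-cycle-separated L 4≤∣L∩C∣ i)
drop-hub L 4≤∣L∩C∣ L-landmark (fsuc i) fzero     _   =
  separated-sym (separated-mono (λ τ∈ _ → L∩C⊆L-hub L τ∈) (hub-cycle-separated L 4≤∣L∩C∣ i))
drop-hub L 4≤∣L∩C∣ L-landmark (fsuc i) (fsuc i') u≢v =
  separated-mono (λ τ∈L separates → x∈p∧x≢y⇒x∈p-y {y = hub} τ∈L
                    λ { refl → hub-separates-no-cycle-pair i i' separates })
    (L-landmark (fsuc i) (fsuc i') u≢v)

mainTheorem15 : (m : ℕ) → 6 ≤ suc m →
    ((X : Subset (suc m)) → GapCondition X → suc m / 2 ≤ ∣ X ∩ C ∣)
    × ((L : Subset (suc m)) → 4 ≤ ∣ L ∩ C ∣ →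
        ((i : Fin m) → SeparatedByAtLeast 2 (L ∩ C) hub (cyc i))
        × (IsAPLandmark 2 L → IsAPLandmark 2 (L - hub)))
mainTheorem15 zero    (s≤s ())
mainTheorem15 (suc k) _ =
  gap-set-bound , λ L 4≤∣L∩C∣ → hub-cycle-separated L 4≤∣L∩C∣ , drop-hub L 4≤∣L∩C∣
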